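{- Let $G$ be a simple graph whose vertices $(v_1,\dots,v_n)$ are in a greedy ordering. For a vertex $v_j$, let $W_j=(w_1,\dots,w_k)$ with $k=k(v_j)$. Then for every $s\in\{1,\dots,k\}$, $k(w_s)<s$.
   Context: For an ordering $(v_1,\dots,v_n)$ of $V(G)$ and $i\le j$, the local degree of $v_j$ at stage $i$ is $|\{h<i: v_hv_j\in E(G)\}|$; the ordering is greedy if for all $i\le j$ the local degree of $v_i$ at stage $i$ is at least that of $v_j$ at stage $i$. For each $j$, $W_j$ is the list, in the order of the vertex ordering, of all $v_i$ with $i<j$ and $v_i$ not adjacent to $v_j$, and $k(v_j)=|W_j|$. -}

module Defs where

open import Data.Nat using (ℕ; _<_; _≤_; _≥_)
open import Data.Fin using (Fin; toℕ; _<?_)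
open import Data.Fin as F using ()
open import Data.List using (List; length; filter; allFin)
open import Data.Empty using (⊥)
open import Relation.Nullary using (¬_; Dec)
open import Relation.Nullary.Decidable using (_×-dec_; ¬?)
open import Data.Product using (_×_)
open import Relation.Binary.PropositionalEquality using (_≡_)

-- The vertex ordering (v_1,…,v_n) is
-- identified with the natural order of Fin n (v_{i+1} is the vertex i).
record SimpleGraph (n : ℕ) : Set₁ where
  field
    Adj     : Fin n → Fin n → Set
    adj?    : (u v : Fin n) → Dec (Adj u v)
    sym     : ∀ {u v} → Adj u v → Adj v u
    irrefl  : ∀ {v} → ¬ Adj v v

module _ {n : ℕ} (G : SimpleGraph n) where
  open SimpleGraph G

  localDegree : Fin n → Fin n → ℕ
  localDegree i j = length (filter (λ h → (h <? i) ×-dec adj? h j) (allFin n))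

  IsGreedy : Set
  IsGreedy = ∀ (i j : Fin n) → toℕ i ≤ toℕ j → localDegree i j ≤ localDegree i i

  W : Fin n → List (Fin n)
  W j = filter (λ i → (i <? j) ×-dec ¬? (adj? i j)) (allFin n)

  k : Fin n → ℕ
  k j = length (W j)

{-# OPTIONS --safe #-}
module Submission where

-- Let w = w_{s+1} be the entry of W_j at (0-based) position s, so w < j and w is not adjacent to j.
-- The vertices preceding w split both as (neighbours + non-neighbours of w) and as
-- (neighbours + non-neighbours of j).  Greedy says w has at least as many earlier neighbours
-- as j at stage w, so k(w) is at most the number of non-neighbours of j before w, and those
-- are exactly the s entries of W_j preceding w.

open import Defs
open import Data.Nat using (ℕ; _<_; _≤_; _+_; suc; s≤s)
open import Data.Nat.Properties using (+-suc; +-monoˡ-≤; +-cancelˡ-≤; <⇒≤; module ≤-Reasoning)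
open import Data.Fin using (Fin; toℕ; zero; suc; _<?_)
import Data.Fin as Fin
import Data.Fin.Properties as Fin
open import Data.List using (List; []; _∷_; length; lookup; filter; allFin)
open import Data.List.Properties using (filter-accept; filter-reject; filter-none)
open import Data.List.Membership.Propositional.Properties using (∈-filter⁻; ∈-lookup)
open import Data.List.Relation.Unary.All as All using (_∷_)
open import Data.List.Relation.Unary.AllPairs using (AllPairs; _∷_)
import Data.List.Relation.Unary.AllPairs.Properties as AllPairs
open import Data.List.Relation.Binary.Sublist.Propositional using (⊆-refl)
open import Data.List.Relation.Binary.Sublist.Propositional.Properties using (filter⁺)
open import Data.List.Relation.Binary.Sublist.Heterogeneous.Properties using (length-mono-≤)
open import Data.Product using (_,_; proj₁; proj₂)
open import Function using (id)
open import Relation.Nullary using (yes; no)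
open import Relation.Nullary.Decidable using (_×-dec_; ¬?)
open import Relation.Unary using (Pred; Decidable)
open import Relation.Binary using (Rel; Asymmetric) renaming (Decidable to Decidable₂)
open import Relation.Binary.PropositionalEquality using (_≡_; refl; cong; sym; trans)

module _ {a p q} {A : Set a} {P : Pred A p} {Q : Pred A q} (P? : Decidable P) (Q? : Decidable Q) where

  filter-filter : ∀ xs → filter Q? (filter P? xs) ≡ filter (λ x → P? x ×-dec Q? x) xs
  filter-filter [] = refl
  filter-filter (x ∷ xs) with P? x | Q? x
  ... | yes px | yes qx = trans (filter-accept Q? qx) (cong (x ∷_) (filter-filter xs))
  ... | yes px | no ¬qx = trans (filter-reject Q? ¬qx) (filter-filter xs)
  ... | no ¬px | _      = filter-filter xs

  length-filter-split : ∀ xs → length (filter P? xs) ≡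
    length (filter (λ x → P? x ×-dec Q? x) xs) + length (filter (λ x → P? x ×-dec ¬? (Q? x)) xs)
  length-filter-split [] = refl
  length-filter-split (x ∷ xs) with P? x | Q? x
  ... | yes _ | yes _ = cong suc (length-filter-split xs)
  ... | yes _ | no _  = trans (cong suc (length-filter-split xs)) (sym (+-suc _ _))
  ... | no _  | _     = length-filter-split xs

  length-filter-mono : (∀ {x} → P x → Q x) → ∀ xs → length (filter P? xs) ≤ length (filter Q? xs)
  length-filter-mono P⇒Q xs = length-mono-≤ (filter⁺ P? Q? (λ { refl → P⇒Q }) (⊆-refl {x = xs}))

module _ {a ℓ} {A : Set a} {_<_ : Rel A ℓ} (<-asym : Asymmetric _<_) (_<?_ : Decidable₂ _<_) where

  length-filter-<-lookup : ∀ {xs} → AllPairs _<_ xs → (s : Fin (length xs)) →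
    length (filter (_<? lookup xs s) xs) ≡ toℕ s
  length-filter-<-lookup {x ∷ xs} (x<xs ∷ _) zero =
    cong length (filter-none (_<? x) ((λ x<x → <-asym x<x x<x) ∷ All.map (λ x<y y<x → <-asym x<y y<x) x<xs))
  length-filter-<-lookup {x ∷ xs} (x<xs ∷ xs-sorted) (suc s) =
    trans (cong length (filter-accept (_<? lookup xs s) (All.lookup x<xs (∈-lookup s))))
          (cong suc (length-filter-<-lookup xs-sorted s))

module _ {n : ℕ} (G : SimpleGraph n) where
  open SimpleGraph G using (adj?)

  nonNeighboursBefore : Fin n → Fin n → ℕ
  nonNeighboursBefore i j = length (filter (λ h → (h <? i) ×-dec ¬? (adj? h j)) (allFin n))

  k≤nonNeighboursBefore : IsGreedy G → ∀ {i j} → toℕ i ≤ toℕ j → k G i ≤ nonNeighboursBefore i j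
  k≤nonNeighboursBefore greedy {i} {j} i≤j = +-cancelˡ-≤ (localDegree G i i) _ _ (begin
    localDegree G i i + k G i                ≡⟨ sym (length-filter-split (_<? i) (λ h → adj? h i) (allFin n)) ⟩
    length (filter (_<? i) (allFin n))       ≡⟨ length-filter-split (_<? i) (λ h → adj? h j) (allFin n) ⟩
    localDegree G i j + nonNeighboursBefore i j ≤⟨ +-monoˡ-≤ _ (greedy i j i≤j) ⟩
    localDegree G i i + nonNeighboursBefore i j ∎)
    where open ≤-Reasoning

  nonNeighboursBefore≤W-before : ∀ {i j} → i Fin.< j → nonNeighboursBefore i j ≤ length (filter (_<? i) (W G j))
  nonNeighboursBefore≤W-before {i} {j} i<j = begin
    nonNeighboursBefore i j
      ≤⟨ length-filter-mono _ _ (λ (h<i , ¬adj) → (Fin.<-trans h<i i<j , ¬adj) , h<i) (allFin n) ⟩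
    length (filter (λ h → ((h <? j) ×-dec ¬? (adj? h j)) ×-dec (h <? i)) (allFin n))
      ≡⟨ cong length (sym (filter-filter _ (_<? i) (allFin n))) ⟩
    length (filter (_<? i) (W G j)) ∎
    where open ≤-Reasoning

  W-sorted : ∀ j → AllPairs Fin._<_ (W G j)
  W-sorted j = AllPairs.filter⁺ _ (AllPairs.tabulate⁺-< id)

mainTheorem14 : ∀ {n : ℕ} (G : SimpleGraph n) → IsGreedy G →
    ∀ (j : Fin n) (s : Fin (length (W G j))) →
      k G (lookup (W G j) s) < suc (toℕ s)
mainTheorem14 {n} G greedy j s = s≤s (begin
  k G w                                  ≤⟨ k≤nonNeighboursBefore G greedy (<⇒≤ w<j) ⟩
  nonNeighboursBefore G w j              ≤⟨ nonNeighboursBefore≤W-before G w<j ⟩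
  length (filter (_<? w) (W G j))        ≡⟨ length-filter-<-lookup Fin.<-asym _<?_ (W-sorted G j) s ⟩
  toℕ s                                  ∎)
  where
  open ≤-Reasoning
  open SimpleGraph G using (adj?)
  w = lookup (W G j) s
  w<j : w Fin.< j
  w<j = proj₁ (proj₂ (∈-filter⁻ (λ i → (i <? j) ×-dec ¬? (adj? i j)) {xs = allFin n} (∈-lookup s)))
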